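{- If $H$ is a graph with $|V(H)|\ge 3$, then ${\rm tw}(C(H))=|V(H)|-1$ and ${\rm tree}\text{ - }\alpha(C(H))\le \alpha(H)$.
   Context: For a graph $H$, the 1-completion $C(H)$ is the graph obtained from $H$ by, for each pair of non-adjacent vertices $u,v$ of $H$, adding a new vertex of degree $2$ adjacent to exactly $u$ and $v$. A tree-decomposition of a graph $G$ is a pair $(T,\{X_t\}_{t\in V(T)})$ where $T$ is a tree and $X_t\subseteq V(G)$, such that every edge of $G$ has both ends in some $X_t$ and for every vertex $v$ the nodes $t$ with $v\in X_t$ induce a non-empty connected subtree of $T$. ${\rm tw}(G)$ is the minimum over tree-decompositions of $\max_t|X_t|-1$; ${\rm tree}\text{ - }\alpha(G)$ is the minimum over tree-decompositions of $\max_t\alpha(G[X_t])$, $\alpha$ denoting the independence number. -}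

module Defs where

open import Data.Nat using (ℕ; zero; suc; _≤_)
open import Data.Fin using (Fin; zero; suc; toℕ; _<_)
open import Data.Bool using (Bool; true; false)
open import Data.Product using (Σ; ∃; ∃-syntax; _×_; _,_; proj₁; proj₂)
open import Data.Sum using (_⊎_; inj₁; inj₂)
open import Data.Empty using (⊥)
open import Data.List using (List; length)
open import Data.List.Membership.Propositional using (_∈_)
open import Data.List.Relation.Binary.Subset.Propositional using (_⊆_)
open import Data.List.Relation.Unary.Unique.Propositional using (Unique)
open import Relation.Nullary using (¬_)
open import Relation.Binary.PropositionalEquality using (_≡_)

record Graph : Set₁ where
  field
    V   : Set
    E   : V → V → Set
    sym : ∀ {u v} → E u v → E v u
    irr : ∀ {u} → ¬ E u u
open Graph public

record SimpleGraph (n : ℕ) : Set where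
  field
    adj     : Fin n → Fin n → Bool
    adj-sym : ∀ u v → adj u v ≡ adj v u
    adj-irr : ∀ u → adj u u ≡ false
open SimpleGraph public

toGraph : ∀ {n} → SimpleGraph n → Graph
toGraph {n} H = record
  { V = Fin n
  ; E = λ u v → adj H u v ≡ true
  ; sym = λ {u} {v} e → Relation.Binary.PropositionalEquality.trans (adj-sym H v u) e
  ; irr = λ {u} e → lem (Relation.Binary.PropositionalEquality.trans (Relation.Binary.PropositionalEquality.sym (adj-irr H u)) e)
  }
  where
    lem : ¬ (false ≡ true)
    lem ()

-- The 1-completion C(H).
-- A non-adjacent pair {u,v} (u ≠ v) is encoded as (u , v) with u < v.

NonEdge : ∀ {n} → SimpleGraph n → Set
NonEdge {n} H = Σ (Fin n × Fin n) λ p → (proj₁ p < proj₂ p) × (adj H (proj₁ p) (proj₂ p) ≡ false)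

CV : ∀ {n} → SimpleGraph n → Set
CV {n} H = Fin n ⊎ NonEdge H

CE : ∀ {n} (H : SimpleGraph n) → CV H → CV H → Set
CE H (inj₁ u) (inj₁ v) = adj H u v ≡ true
CE H (inj₁ u) (inj₂ ((a , b) , _)) = (u ≡ a) ⊎ (u ≡ b)
CE H (inj₂ ((a , b) , _)) (inj₁ u) = (u ≡ a) ⊎ (u ≡ b)
CE H (inj₂ _) (inj₂ _) = ⊥

CE-sym : ∀ {n} (H : SimpleGraph n) {x y : CV H} → CE H x y → CE H y x
CE-sym H {inj₁ u} {inj₁ v} e = Relation.Binary.PropositionalEquality.trans (adj-sym H v u) e
CE-sym H {inj₁ u} {inj₂ _} e = e
CE-sym H {inj₂ _} {inj₁ u} e = e
CE-sym H {inj₂ _} {inj₂ _} ()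

CE-irr : ∀ {n} (H : SimpleGraph n) {x : CV H} → ¬ CE H x x
CE-irr H {inj₁ u} e = Graph.irr (toGraph H) e
CE-irr H {inj₂ _} ()

C : ∀ {n} → SimpleGraph n → Graph
C H = record { V = CV H ; E = CE H ; sym = CE-sym H ; irr = CE-irr H }

-- A tree on nodes Fin (suc m) is given by a parent
-- function: node (suc i) has parent (parent i), a node with smaller
-- index.  Every finite tree arises this way (root it, number nodes
-- in BFS order), and every such structure is a tree.

record Tree : Set where
  field
    m       : ℕ
    parent  : Fin m → Fin (suc m)
    parent< : ∀ i → toℕ (parent i) ≤ toℕ i
open Tree public

Node : Tree → Set
Node T = Fin (suc (m T))

TAdj : (T : Tree) → Node T → Node T → Set
TAdj T s t = ∃[ i ] ((s ≡ suc i × t ≡ parent T i) ⊎ (t ≡ suc i × s ≡ parent T i))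

data Walk (T : Tree) (P : Node T → Set) : Node T → Node T → Set where
  stop : ∀ {t} → P t → Walk T P t t
  step : ∀ {s u t} → P s → TAdj T s u → Walk T P u t → Walk T P s t

record TreeDecomposition (G : Graph) : Set₁ where
  field
    tree   : Tree
    bag    : Node tree → List (V G)
    bag-unique : ∀ t → Unique (bag t)
    vertex-cover : ∀ (v : V G) → ∃[ t ] (v ∈ bag t)
    edge-cover   : ∀ (u v : V G) → E G u v → ∃[ t ] (u ∈ bag t × v ∈ bag t)
    connected    : ∀ (v : V G) (s t : Node tree) → v ∈ bag s → v ∈ bag t →
                   Walk tree (λ r → v ∈ bag r) s t
open TreeDecomposition public

WidthAtMost : ∀ {G} → TreeDecomposition G → ℕ → Set
WidthAtMost D k = ∀ t → length (bag D t) ≤ suc k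

Treewidth : Graph → ℕ → Set₁
Treewidth G k =
  (Σ (TreeDecomposition G) λ D → WidthAtMost D k) ×
  (∀ (D : TreeDecomposition G) → ∃[ t ] (suc k ≤ length (bag D t)))

Independent : (G : Graph) → List (V G) → Set
Independent G I = Unique I × (∀ {u v} → u ∈ I → v ∈ I → ¬ E G u v)

IndependenceNumber : Graph → ℕ → Set
IndependenceNumber G a =
  (Σ (List (V G)) λ I → Independent G I × length I ≡ a) ×
  (∀ I → Independent G I → length I ≤ a)

AlphaInducedAtMost : (G : Graph) → List (V G) → ℕ → Set
AlphaInducedAtMost G X a = ∀ I → I ⊆ X → Independent G I → length I ≤ a

TreeAlphaAtMost : Graph → ℕ → Set₁
TreeAlphaAtMost G a =
  Σ (TreeDecomposition G) λ D → ∀ t → AlphaInducedAtMost G (bag D t) a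

{-# OPTIONS --safe #-}
-- Upper bound: a star decomposition of C(H) with centre bag V(H) and, for every non-edge uv with
-- subdivision vertex x, a leaf bag {x, u, v}. Its bags have at most max(|V(H)|, 3) vertices; an
-- independent set of C(H) inside V(H) is one of H, and one inside {x, u, v} has at most 2 vertices,
-- while {u, v} itself is independent in H.
--
-- Lower bound: sending each subdivision vertex of uv (u < v) to u contracts C(H) onto the complete
-- graph on V(H). In a tree-decomposition the nodes whose bags meet a fixed fibre form a subtree, any
-- two of these subtrees intersect, so by the Helly property of subtrees one bag meets all |V(H)| fibres.
module Submission where

open import Defs
open import Data.Nat using (ℕ; zero; suc; _≤_; _∸_; _*_; z≤n; s≤s)
open import Data.Nat.Properties using (≤-refl; ≤-trans; ≤-reflexive; <⇒≱; n≤1+n; module ≤-Reasoning)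
open import Data.Fin using (Fin; zero; suc; toℕ; combine; remQuot) renaming (_<_ to _<ᶠ_)
open import Data.Fin.Properties
  using (_≟_; _<?_; <-cmp; <-irrelevant; <⇒≢; remQuot-combine; combine-remQuot)
open import Data.Fin.Induction using (<-wellFounded)
open import Data.Bool using (true; false)
import Data.Bool.Properties as Bool
open import Data.Maybe using (Maybe; just; nothing)
open import Function using (_∘_)
open import Data.Product using (Σ-syntax; ∃-syntax; ∃₂; _×_; _,_; proj₁; proj₂; uncurry)
open import Data.Sum using (_⊎_; inj₁; inj₂)
open import Data.Sum.Properties using (inj₁-injective)
open import Data.Empty using (⊥-elim)
open import Data.List using (List; []; _∷_; [_]; length; map; allFin)
open import Data.List.Properties using (length-map; length-tabulate; length-removeAt′)
open import Data.List.Extrema.Nat using (argmax; f[xs]≤f[argmax])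
open import Data.List.Relation.Unary.All as All using ([]; _∷_)
open import Data.List.Relation.Unary.AllPairs using ([]; _∷_)
open import Data.List.Relation.Unary.Any as Any using (Any; here; there; any?; _─_; index)
import Data.List.Relation.Unary.Any.Properties as Any
open import Data.List.Membership.Propositional using (_∈_; find; lose)
open import Data.List.Membership.Propositional.Properties using (∈-map⁺; ∈-map⁻; ∈-allFin)
open import Data.List.Relation.Binary.Subset.Propositional using (_⊆_)
open import Data.List.Relation.Unary.Unique.Propositional using (Unique)
import Data.List.Relation.Unary.Unique.Propositional.Properties as Unique
open import Axiom.UniquenessOfIdentityProofs using (module Decidable⇒UIP)
open import Induction.WellFounded using (Acc; acc)
open import Relation.Nullary using (¬_; yes; no)
open import Relation.Unary using (Decidable)
open import Relation.Binary.Definitions using (tri<; tri≈; tri>)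
open import Relation.Binary.PropositionalEquality as ≡ using (_≡_; _≢_; refl; cong; cong₂; subst; ≢-sym)

module _ {A : Set} where

  ∈-─ : ∀ {x y : A} {xs} (x∈xs : x ∈ xs) → y ∈ xs → y ≢ x → y ∈ (xs ─ x∈xs)
  ∈-─ (here refl) (here refl) y≢x = ⊥-elim (y≢x refl)
  ∈-─ (here _)    (there y∈xs) _  = y∈xs
  ∈-─ (there _)   (here refl) _   = here refl
  ∈-─ (there x∈xs) (there y∈xs) y≢x = there (∈-─ x∈xs y∈xs y≢x)

  Unique-⊆⇒length≤ : ∀ {xs ys : List A} → Unique xs → xs ⊆ ys → length xs ≤ length ys
  Unique-⊆⇒length≤ {[]} _ _ = z≤n
  Unique-⊆⇒length≤ {x ∷ xs} {ys} (x∉xs ∷ xs!) x∷xs⊆ys = begin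
    suc (length xs)          ≤⟨ s≤s (Unique-⊆⇒length≤ xs! xs⊆ys─x) ⟩
    suc (length (ys ─ x∈ys)) ≡⟨ ≡.sym (length-removeAt′ ys (index x∈ys)) ⟩
    length ys                ∎
    where
      open ≤-Reasoning
      x∈ys : x ∈ ys
      x∈ys = x∷xs⊆ys (here refl)
      xs⊆ys─x : xs ⊆ (ys ─ x∈ys)
      xs⊆ys─x y∈xs = ∈-─ x∈ys (x∷xs⊆ys (there y∈xs)) (≢-sym (All.lookup x∉xs y∈xs))

  ⊆-map⇒≡map : ∀ {B : Set} {f : B → A} xs {ys} → xs ⊆ map f ys → ∃[ zs ] xs ≡ map f zs
  ⊆-map⇒≡map [] _ = [] , refl
  ⊆-map⇒≡map {f = f} (x ∷ xs) x∷xs⊆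
    with ∈-map⁻ f (x∷xs⊆ (here refl)) | ⊆-map⇒≡map xs (λ y∈ → x∷xs⊆ (there y∈))
  ... | z , _ , refl | zs , refl = z ∷ zs , refl

enumeration⇒≤length : ∀ {k} (xs : List (Fin k)) → (∀ i → i ∈ xs) → k ≤ length xs
enumeration⇒≤length {k} xs ∈xs =
  subst (_≤ length xs) (length-tabulate {n = k} (λ i → i))
    (Unique-⊆⇒length≤ (Unique.allFin⁺ k) (λ {i} _ → ∈xs i))

argmaxFin : ∀ {k} (f : Fin (suc k) → ℕ) → ∃[ i ] (∀ j → f j ≤ f i)
argmaxFin {k} f =
  argmax f zero (allFin (suc k)) ,
  λ j → All.lookup (f[xs]≤f[argmax] {f = f} zero (allFin (suc k))) (∈-allFin j)

-- Subtrees and the Helly property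

IsSubtree : (T : Tree) → (Node T → Set) → Set
IsSubtree T P = ∀ {s t} → P s → P t → Walk T P s t

data AncestorWithin (T : Tree) (P : Node T → Set) : Node T → Node T → Set where
  here : ∀ {w} → P w → AncestorWithin T P w w
  up   : ∀ {c} i → P (suc i) → AncestorWithin T P c (parent T i) → AncestorWithin T P c (suc i)

module _ {T : Tree} where

  walk-++ : ∀ {P s u t} → Walk T P s u → Walk T P u t → Walk T P s t
  walk-++ (stop _)        w = w
  walk-++ (step p s~u w₁) w = step p s~u (walk-++ w₁ w)

  walk-map : ∀ {P Q : Node T → Set} {s t} → (∀ {r} → P r → Q r) → Walk T P s t → Walk T Q s t
  walk-map f (stop p)       = stop (f p)
  walk-map f (step p s~u w) = step (f p) s~u (walk-map f w)

  AncestorWithin⇒P : ∀ {P c w} → AncestorWithin T P c w → P w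
  AncestorWithin⇒P (here p)   = p
  AncestorWithin⇒P (up _ p _) = p

  AncestorWithin-trans : ∀ {P c d w} →
    AncestorWithin T P c d → AncestorWithin T P d w → AncestorWithin T P c w
  AncestorWithin-trans c↑d (here _)     = c↑d
  AncestorWithin-trans c↑d (up i p d↑w) = up i p (AncestorWithin-trans c↑d d↑w)

  AncestorWithin⇒≤ : ∀ {P c w} → AncestorWithin T P c w → toℕ c ≤ toℕ w
  AncestorWithin⇒≤ (here _)     = ≤-refl
  AncestorWithin⇒≤ (up i _ c↑w) = ≤-trans (AncestorWithin⇒≤ c↑w) (≤-trans (parent< T i) (n≤1+n _))

  walk⇒commonAncestor : ∀ {P s t} → Walk T P s t → ∃[ c ] (AncestorWithin T P c s × AncestorWithin T P c t)
  walk⇒commonAncestor (stop p) = _ , here p , here p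
  walk⇒commonAncestor (step p (i , inj₁ (refl , refl)) w) with walk⇒commonAncestor w
  ... | c , c↑u , c↑t = c , up i p c↑u , c↑t
  walk⇒commonAncestor (step p (i , inj₂ (refl , refl)) w) with walk⇒commonAncestor w
  ... | _ , here pu , u↑t   = _ , here p , AncestorWithin-trans (up i pu (here p)) u↑t
  ... | c , up _ _ c↑s , c↑t = c , c↑s , c↑t

  -- Two ancestors of w are comparable; the lower one lies on the path from w up to the higher.
  AncestorWithin-lower : ∀ {P Q c d w} →
    AncestorWithin T P c w → AncestorWithin T Q d w → toℕ c ≤ toℕ d → P d
  AncestorWithin-lower (here p)     (here _)     _   = p
  AncestorWithin-lower (here _)     (up i _ d↑w) c≤d =
    ⊥-elim (<⇒≱ (s≤s (≤-trans (AncestorWithin⇒≤ d↑w) (parent< T i))) c≤d)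
  AncestorWithin-lower (up _ p _)   (here _)     _   = p
  AncestorWithin-lower (up i _ c↑w) (up i _ d↑w) c≤d = AncestorWithin-lower c↑w d↑w c≤d

module _ (T : Tree) {P : Node T → Set} (P? : Decidable P) where

  highestAncestorWithin : ∀ {w} → P w →
    Σ[ c ∈ Node T ] (AncestorWithin T P c w × (∀ {d} → AncestorWithin T P d w → AncestorWithin T P c d))
  highestAncestorWithin = climb (<-wellFounded _)
    where
      climb : ∀ {w} → Acc _<ᶠ_ w → P w →
        Σ[ c ∈ Node T ] (AncestorWithin T P c w × (∀ {d} → AncestorWithin T P d w → AncestorWithin T P c d))
      climb {zero} _ p = zero , here p , λ { (here _) → here p }
      climb {suc i} (acc rs) p with P? (parent T i)
      ... | no ¬p′ =
        suc i , here p , λ { (here _) → here p ; (up _ _ d↑) → ⊥-elim (¬p′ (AncestorWithin⇒P d↑)) }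
      ... | yes p′ with climb (rs {parent T i} (s≤s (parent< T i))) p′
      ...   | c , c↑ , highest = c , up i p c↑ , λ { (here _) → up i p c↑ ; (up _ _ d↑) → highest d↑ }

  subtreeRoot : IsSubtree T P → ∀ {b} → P b → Σ[ r ∈ Node T ] (∀ {w} → P w → AncestorWithin T P r w)
  subtreeRoot isSubtree pb with highestAncestorWithin pb
  ... | r , _ , highest = r , below-r
    where
      below-r : ∀ {w} → P w → AncestorWithin T P r w
      below-r pw with walk⇒commonAncestor (isSubtree pb pw)
      ... | _ , c↑b , c↑w = AncestorWithin-trans (highest c↑b) c↑w

-- root i and root d are both ancestors of a node of P i ∩ P d, and root d is the lower one.
deepestRoot∈all : ∀ {T k} {P : Fin k → Node T → Set} (root : Fin k → Node T) →
                  (∀ i {w} → P i w → AncestorWithin T (P i) (root i) w) → (∀ i j → ∃[ t ] (P i t × P j t)) →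
                  ∀ {d} → (∀ i → toℕ (root i) ≤ toℕ (root d)) → ∀ i → P i (root d)
deepestRoot∈all root below meet {d} deepest i with meet i d
... | w , w∈i , w∈d = AncestorWithin-lower (below i w∈i) (below d w∈d) (deepest i)

helly : ∀ (T : Tree) {k} (P : Fin k → Node T → Set) → (∀ i → Decidable (P i)) →
        (∀ i → IsSubtree T (P i)) → (∀ i j → ∃[ t ] (P i t × P j t)) → ∃[ t ] (∀ i → P i t)
helly T {zero}  P _  _         _    = zero , λ ()
helly T {suc k} P P? isSubtree meet = root deepest , deepestRoot∈all root below meet deepest-is-max
  where
    roots : ∀ i → Σ[ r ∈ Node T ] (∀ {w} → P i w → AncestorWithin T (P i) r w)
    roots i = subtreeRoot T (P? i) (isSubtree i) (proj₁ (proj₂ (meet i i)))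
    root : Fin (suc k) → Node T
    root i = proj₁ (roots i)
    below : ∀ i {w} → P i w → AncestorWithin T (P i) (root i) w
    below i = proj₂ (roots i)
    deepest : Fin (suc k)
    deepest = proj₁ (argmaxFin (toℕ ∘ root))
    deepest-is-max : ∀ i → toℕ (root i) ≤ toℕ (root deepest)
    deepest-is-max = proj₂ (argmaxFin (toℕ ∘ root))

-- Complete contractions and large bags

data WalkIn (G : Graph) (P : V G → Set) : V G → V G → Set where
  stop : ∀ {x} → P x → WalkIn G P x x
  step : ∀ {x y z} → P x → E G x y → WalkIn G P y z → WalkIn G P x z

walkIn-++ : ∀ {G P x y z} → WalkIn G P x y → WalkIn G P y z → WalkIn G P x z
walkIn-++ (stop _)        w = w
walkIn-++ (step p x~y w₁) w = step p x~y (walkIn-++ w₁ w)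

Touching : (G : Graph) → V G → V G → Set
Touching G x y = x ≡ y ⊎ E G x y

-- The fibres of branch are the branch sets of a K_k minor of G covering all of V G.
record CompleteContraction (G : Graph) (k : ℕ) : Set where
  field
    branch           : V G → Fin k
    branch-connected : ∀ {i x y} → branch x ≡ i → branch y ≡ i → WalkIn G (λ z → branch z ≡ i) x y
    branches-touch   : ∀ i j → ∃₂ λ x y → branch x ≡ i × branch y ≡ j × Touching G x y

module _ {G : Graph} (D : TreeDecomposition G) where

  Meets : (V G → Set) → Node (tree D) → Set
  Meets P t = Any P (bag D t)

  walkIn⇒walk-meeting : ∀ {P x y s t} → WalkIn G P x y → x ∈ bag D s → y ∈ bag D t →
                        Walk (tree D) (Meets P) s t
  walkIn⇒walk-meeting {x = x} {s = s} {t} (stop px) x∈s x∈t =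
    walk-map (λ x∈r → lose x∈r px) (connected D x s t x∈s x∈t)
  walkIn⇒walk-meeting {x = x} {s = s} (step px x~z w) x∈s y∈t with edge-cover D x _ x~z
  ... | q , x∈q , z∈q =
    walk-++ (walk-map (λ x∈r → lose x∈r px) (connected D x s q x∈s x∈q)) (walkIn⇒walk-meeting w z∈q y∈t)

  touching⇒sharedBag : ∀ {x y} → Touching G x y → ∃[ t ] (x ∈ bag D t × y ∈ bag D t)
  touching⇒sharedBag {x} (inj₁ refl) = let t , x∈t = vertex-cover D x in t , x∈t , x∈t
  touching⇒sharedBag {x} {y} (inj₂ x~y) = edge-cover D x y x~y

  completeContraction⇒largeBag : ∀ {k} → CompleteContraction G k → ∃[ t ] (k ≤ length (bag D t))
  completeContraction⇒largeBag {k} K =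
    t , subst (k ≤_) (length-map branch (bag D t)) (enumeration⇒≤length _ every∈)
    where
      open CompleteContraction K
      MeetsFibre : Fin k → Node (tree D) → Set
      MeetsFibre i = Meets (λ z → branch z ≡ i)
      meets? : ∀ i → Decidable (MeetsFibre i)
      meets? i t = any? (λ z → branch z ≟ i) (bag D t)
      subtree : ∀ i → IsSubtree (tree D) (MeetsFibre i)
      subtree i ms mt with find ms | find mt
      ... | _ , x∈s , bx | _ , y∈t , by = walkIn⇒walk-meeting (branch-connected bx by) x∈s y∈t
      meet : ∀ i j → ∃[ t ] (MeetsFibre i t × MeetsFibre j t)
      meet i j with branches-touch i j
      ... | _ , _ , bx , by , x~y with touching⇒sharedBag x~y
      ...   | t , x∈t , y∈t = t , lose x∈t bx , lose y∈t by
      common : ∃[ t ] (∀ i → MeetsFibre i t)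
      common = helly (tree D) MeetsFibre meets? subtree meet
      t : Node (tree D)
      t = proj₁ common
      every∈ : ∀ i → i ∈ map branch (bag D t)
      every∈ i = Any.map⁺ {f = branch} (Any.map ≡.sym (proj₂ common i))

-- Star decompositions and independent sets

star : ℕ → Tree
star m = record { m = m ; parent = λ _ → zero ; parent< = λ _ → z≤n }

module _ {A : Set} {m} (centre : List A) (leaf : Fin m → List A) where

  starBags : Node (star m) → List A
  starBags zero    = centre
  starBags (suc i) = leaf i

  star-connected : (∀ {v} i j → v ∈ leaf i → v ∈ leaf j → v ∈ centre ⊎ i ≡ j) →
                   ∀ v s t → v ∈ starBags s → v ∈ starBags t → Walk (star m) (λ r → v ∈ starBags r) s t
  star-connected _ v zero    zero    _   v∈t = stop v∈t
  star-connected _ v zero    (suc j) v∈s v∈t = step v∈s (j , inj₂ (refl , refl)) (stop v∈t)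
  star-connected _ v (suc i) zero    v∈s v∈t = step v∈s (i , inj₁ (refl , refl)) (stop v∈t)
  star-connected shared⇒central v (suc i) (suc j) v∈s v∈t with shared⇒central i j v∈s v∈t
  ... | inj₁ v∈c  = step v∈s (i , inj₁ (refl , refl)) (step v∈c (j , inj₂ (refl , refl)) (stop v∈t))
  ... | inj₂ refl = stop v∈t

independent-pair : ∀ {G : Graph} {x y} → x ≢ y → ¬ E G x y → Independent G (x ∷ y ∷ [])
independent-pair {G} x≢y x≁y = ((x≢y ∷ []) ∷ [] ∷ []) , nonadjacent
  where
    nonadjacent : ∀ {u v} → u ∈ _ ∷ _ ∷ [] → v ∈ _ ∷ _ ∷ [] → ¬ E G u v
    nonadjacent (here refl)         (here refl)         = irr G
    nonadjacent (here refl)         (there (here refl)) = x≁y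
    nonadjacent (there (here refl)) (here refl)         = λ y~x → x≁y (sym G y~x)
    nonadjacent (there (here refl)) (there (here refl)) = irr G

independent-⊆-cone : ∀ {G : Graph} {c ys I} → (∀ {y} → y ∈ ys → E G c y) →
                     Independent G I → I ⊆ c ∷ ys → I ⊆ [ c ] ⊎ I ⊆ ys
independent-⊆-cone {I = []} _ _ _ = inj₂ λ ()
independent-⊆-cone {G} {c} {ys} {y ∷ I} apex (_ , indep) I⊆ with I⊆ (here refl)
... | here refl = inj₁ only-c
  where
    only-c : y ∷ I ⊆ [ c ]
    only-c z∈I with I⊆ z∈I
    ... | here z≡c   = here z≡c
    ... | there z∈ys = ⊥-elim (indep (here refl) z∈I (apex z∈ys))
... | there y∈ys = inj₂ avoid-c
  where
    avoid-c : y ∷ I ⊆ ys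
    avoid-c z∈I with I⊆ z∈I
    ... | here refl  = ⊥-elim (indep z∈I (here refl) (apex y∈ys))
    ... | there z∈ys = z∈ys

module _ {n} (H : SimpleGraph n) where

  owner : CV H → Fin n
  owner (inj₁ u)             = u
  owner (inj₂ ((u , _) , _)) = u

  walk-to-owner : ∀ {i} y → owner y ≡ i → WalkIn (C H) (λ z → owner z ≡ i) y (inj₁ i)
  walk-to-owner (inj₁ _) refl = stop refl
  walk-to-owner (inj₂ _) refl = step refl (inj₁ refl) (stop refl)

  walk-from-owner : ∀ {i} y → owner y ≡ i → WalkIn (C H) (λ z → owner z ≡ i) (inj₁ i) y
  walk-from-owner (inj₁ _) refl = stop refl
  walk-from-owner (inj₂ _) refl = step refl (inj₁ refl) (stop refl)

  touching-owners< : ∀ {u v} → u <ᶠ v → ∃₂ λ x y → owner x ≡ u × owner y ≡ v × E (C H) x y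
  touching-owners< {u} {v} u<v with adj H u v in uv
  ... | true  = inj₁ u , inj₁ v , refl , refl , uv
  ... | false = inj₂ ((u , v) , u<v , uv) , inj₁ v , refl , refl , inj₂ refl

  touching-owners : ∀ u v → ∃₂ λ x y → owner x ≡ u × owner y ≡ v × Touching (C H) x y
  touching-owners u v with <-cmp u v
  ... | tri< u<v _ _ = let x , y , ox , oy , x~y = touching-owners< u<v in x , y , ox , oy , inj₂ x~y
  ... | tri≈ _ refl _ = inj₁ u , inj₁ u , refl , refl , inj₁ refl
  ... | tri> _ _ v<u =
    let x , y , ox , oy , x~y = touching-owners< v<u in y , x , oy , ox , inj₂ (sym (C H) x~y)

  ownerContraction : CompleteContraction (C H) n
  ownerContraction = record
    { branch           = owner
    ; branch-connected = λ {_} {x} {y} ox oy → walkIn-++ (walk-to-owner x ox) (walk-from-owner y oy)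
    ; branches-touch   = touching-owners
    }

  nonEdge? : Fin n → Fin n → Maybe (NonEdge H)
  nonEdge? u v with u <? v | adj H u v Bool.≟ false
  ... | yes u<v | yes u≁v = just ((u , v) , u<v , u≁v)
  ... | yes _   | no _    = nothing
  ... | no _    | _       = nothing

  nonEdge?-sound : ∀ u v {x} → nonEdge? u v ≡ just x → proj₁ x ≡ (u , v)
  nonEdge?-sound u v eq with u <? v | adj H u v Bool.≟ false
  nonEdge?-sound u v refl | yes _ | yes _ = refl

  nonEdge?-complete : ∀ (x : NonEdge H) → uncurry nonEdge? (proj₁ x) ≡ just x
  nonEdge?-complete ((u , v) , u<v , u≁v) with u <? v | adj H u v Bool.≟ false
  ... | yes u<v′ | yes u≁v′ = cong₂ (λ p q → just ((u , v) , p , q))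
                                    (<-irrelevant u<v′ u<v) (Decidable⇒UIP.≡-irrelevant Bool._≟_ u≁v′ u≁v)
  ... | yes _    | no ¬u≁v  = ⊥-elim (¬u≁v u≁v)
  ... | no ¬u<v  | _        = ⊥-elim (¬u<v u<v)

  nonEdgeBag : NonEdge H → List (CV H)
  nonEdgeBag x@((u , v) , _) = inj₂ x ∷ inj₁ u ∷ inj₁ v ∷ []

  optionalBag : Maybe (NonEdge H) → List (CV H)
  optionalBag (just x) = nonEdgeBag x
  optionalBag nothing  = []

  centre : List (CV H)
  centre = map inj₁ (allFin n)

  -- Leaves are indexed by the pairs (u, v) via Fin (n * n); a pair that is not a non-edge with u < v
  -- gets an empty bag.
  leafBag : Fin (n * n) → List (CV H)
  leafBag i = optionalBag (uncurry nonEdge? (remQuot n i))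

  leafOf : NonEdge H → Fin (n * n)
  leafOf x = uncurry combine (proj₁ x)

  leafBag-leafOf : ∀ x → leafBag (leafOf x) ≡ nonEdgeBag x
  leafBag-leafOf x = cong optionalBag (begin
    uncurry nonEdge? (remQuot n (leafOf x)) ≡⟨ cong (uncurry nonEdge?) (remQuot-combine _ _) ⟩
    uncurry nonEdge? (proj₁ x)              ≡⟨ nonEdge?-complete x ⟩
    just x                                  ∎)
    where open ≡.≡-Reasoning

  optionalBag-inj₂ : ∀ mx {x} → inj₂ x ∈ optionalBag mx → mx ≡ just x
  optionalBag-inj₂ (just _) (here refl) = refl
  optionalBag-inj₂ (just _) (there (there (there ())))

  inj₂∈leafBag⇒leafOf : ∀ {x} i → inj₂ x ∈ leafBag i → i ≡ leafOf x
  inj₂∈leafBag⇒leafOf {x} i x∈i = begin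
    i
      ≡⟨ ≡.sym (combine-remQuot {n} n i) ⟩
    uncurry combine (remQuot {n} n i)
      ≡⟨ cong (uncurry combine) (≡.sym (nonEdge?-sound _ _ (optionalBag-inj₂ _ x∈i))) ⟩
    leafOf x
      ∎
    where open ≡.≡-Reasoning

  starDecomposition : TreeDecomposition (C H)
  starDecomposition = record
    { tree         = star (n * n)
    ; bag          = starBags centre leafBag
    ; bag-unique   = bags-unique
    ; vertex-cover = covers-vertex
    ; edge-cover   = covers-edge
    ; connected    = star-connected centre leafBag shared⇒central
    }
    where
      inj₁∈centre : ∀ u → inj₁ u ∈ centre
      inj₁∈centre u = ∈-map⁺ inj₁ (∈-allFin u)

      ∈leafOf : ∀ x {y} → y ∈ nonEdgeBag x → y ∈ leafBag (leafOf x)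
      ∈leafOf x = subst (_ ∈_) (≡.sym (leafBag-leafOf x))

      optionalBag-unique : ∀ mx → Unique (optionalBag mx)
      optionalBag-unique nothing = []
      optionalBag-unique (just ((u , v) , u<v , _)) =
        ((λ ()) ∷ (λ ()) ∷ []) ∷ ((λ u≡v → <⇒≢ u<v (inj₁-injective u≡v)) ∷ []) ∷ [] ∷ []

      bags-unique : ∀ t → Unique (starBags centre leafBag t)
      bags-unique zero    = Unique.map⁺ inj₁-injective (Unique.allFin⁺ n)
      bags-unique (suc i) = optionalBag-unique _

      covers-vertex : ∀ y → ∃[ t ] (y ∈ starBags centre leafBag t)
      covers-vertex (inj₁ u) = zero , inj₁∈centre u
      covers-vertex (inj₂ x) = suc (leafOf x) , ∈leafOf x (here refl)

      endpoint∈ : ∀ {u} (x : NonEdge H) → CE H (inj₁ u) (inj₂ x) → inj₁ u ∈ nonEdgeBag x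
      endpoint∈ _ (inj₁ refl) = there (here refl)
      endpoint∈ _ (inj₂ refl) = there (there (here refl))

      covers-edge : ∀ y z → CE H y z →
                    ∃[ t ] (y ∈ starBags centre leafBag t × z ∈ starBags centre leafBag t)
      covers-edge (inj₁ u) (inj₁ v) _   = zero , inj₁∈centre u , inj₁∈centre v
      covers-edge (inj₁ _) (inj₂ x) u~x = suc (leafOf x) , ∈leafOf x (endpoint∈ x u~x) , ∈leafOf x (here refl)
      covers-edge (inj₂ x) (inj₁ _) x~u = suc (leafOf x) , ∈leafOf x (here refl) , ∈leafOf x (endpoint∈ x x~u)

      shared⇒central : ∀ {y} i j → y ∈ leafBag i → y ∈ leafBag j → y ∈ centre ⊎ i ≡ j
      shared⇒central {inj₁ u} _ _ _   _   = inj₁ (inj₁∈centre u)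
      shared⇒central {inj₂ x} i j x∈i x∈j =
        inj₂ (≡.trans (inj₂∈leafBag⇒leafOf i x∈i) (≡.sym (inj₂∈leafBag⇒leafOf j x∈j)))

  starDecomposition-width : 3 ≤ n → ∀ t → length (bag starDecomposition t) ≤ n
  starDecomposition-width _   zero    =
    ≤-reflexive (≡.trans (length-map inj₁ (allFin n)) (length-tabulate {n = n} (λ i → i)))
  starDecomposition-width 3≤n (suc i) = ≤-trans (optionalBag-length (uncurry nonEdge? (remQuot n i))) 3≤n
    where
      optionalBag-length : ∀ mx → length (optionalBag mx) ≤ 3
      optionalBag-length (just _) = ≤-reflexive refl
      optionalBag-length nothing  = z≤n

  inj₁-reflects-independence : ∀ {J} → Independent (C H) (map inj₁ J) → Independent (toGraph H) J
  inj₁-reflects-independence (J! , indep) =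
    Unique.map⁻ J! , λ u∈J v∈J → indep (∈-map⁺ inj₁ u∈J) (∈-map⁺ inj₁ v∈J)

  module _ {a} (maximum : ∀ I → Independent (toGraph H) I → length I ≤ a) where

    centre-α : AlphaInducedAtMost (C H) centre a
    centre-α I I⊆centre I-indep with ⊆-map⇒≡map I I⊆centre
    ... | J , refl =
      ≤-trans (≤-reflexive (length-map inj₁ J)) (maximum J (inj₁-reflects-independence I-indep))

    nonEdgeBag-α : ∀ x → AlphaInducedAtMost (C H) (nonEdgeBag x) a
    nonEdgeBag-α x@((u , v) , u<v , u≁v) I I⊆ I-indep = ≤-trans |I|≤2 2≤a
      where
        2≤a : 2 ≤ a
        2≤a = maximum (u ∷ v ∷ []) (independent-pair {toGraph H} (<⇒≢ u<v) (Bool.not-¬ u≁v))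
        apex : ∀ {y} → y ∈ inj₁ u ∷ inj₁ v ∷ [] → E (C H) (inj₂ x) y
        apex (here refl)         = inj₁ refl
        apex (there (here refl)) = inj₂ refl
        |I|≤2 : length I ≤ 2
        |I|≤2 with independent-⊆-cone {C H} apex I-indep I⊆
        ... | inj₁ I⊆x  = ≤-trans (Unique-⊆⇒length≤ (proj₁ I-indep) I⊆x) (n≤1+n 1)
        ... | inj₂ I⊆uv = Unique-⊆⇒length≤ (proj₁ I-indep) I⊆uv

    starDecomposition-α : ∀ t → AlphaInducedAtMost (C H) (bag starDecomposition t) a
    starDecomposition-α zero    = centre-α
    starDecomposition-α (suc i) = optionalBag-α (uncurry nonEdge? (remQuot n i))
      where
        optionalBag-α : ∀ mx → AlphaInducedAtMost (C H) (optionalBag mx) a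
        optionalBag-α (just x) = nonEdgeBag-α x
        optionalBag-α nothing  = λ I I⊆[] I-indep → ≤-trans (Unique-⊆⇒length≤ (proj₁ I-indep) I⊆[]) z≤n

lemma2p2 : ∀ (n : ℕ) (H : SimpleGraph n) → 3 ≤ n →
    Treewidth (C H) (n ∸ 1) × (∀ (a : ℕ) → IndependenceNumber (toGraph H) a → TreeAlphaAtMost (C H) a)
lemma2p2 zero    H ()
lemma2p2 (suc k) H 3≤n =
  ( (starDecomposition H , starDecomposition-width H 3≤n)
  , (λ D → completeContraction⇒largeBag D (ownerContraction H)) )
  , λ a α → starDecomposition H , starDecomposition-α H (proj₂ α)
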